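{- Let $T$ be an ordered rooted tree and $F$ a nonempty subforest of $T$. Then: (1) every node of $R_F$ lies in $RU_G$ for every nonempty subforest $G$ of $T$ whose nodes all lie in $L'_F$; and every node of $L_F$ lies in $LU_G$ for every nonempty subforest $G$ of $T$ whose nodes all lie in $R'_F$. (So the transition $F\to L'_F$ right-removes $\mathsf{size}(R_F)$ nodes and $F\to R'_F$ left-removes $\mathsf{size}(L_F)$ nodes.) (2) for every nonempty subforest $G$ of $T$ whose nodes all lie in $R^\circ_F$, every node of $L'_F$ lies in $LU_G$ and $r_F\in MU_G$; and for every nonempty subforest $G$ of $T$ whose nodes all lie in $L^\circ_F$, every node of $R'_F$ lies in $RU_G$ and $\ell_F\in MU_G$. (So the transition $F\to R^\circ_F$ left-removes $\mathsf{size}(F-R_F)$ nodes and middle-removes one node, and $F\to L^\circ_F$ right-removes $\mathsf{size}(F-L_F)$ nodes and middle-removes one node.)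
   Context: Ordered rooted trees and forests: children of each node are linearly ordered, a forest is a linearly ordered sequence of trees. Removing a node $v$ from a forest deletes $v$ and puts its children, in order, in the place of $v$. A subforest of $T$ is a forest obtained from $T$ by repeatedly removing the leftmost or rightmost root; its nodes form a subset of the nodes of $T$. For a nonempty forest $F$: $L_F,R_F$ are its leftmost and rightmost trees, $\ell_F,r_F$ their roots; $L'_F=F-R_F$ (all trees but the rightmost), $R'_F=F-L_F$; $R^\circ_F$ is $R_F$ with $r_F$ removed, $L^\circ_F$ is $L_F$ with $\ell_F$ removed; $\mathsf{size}$ counts nodes. Let $\mathsf{pre}(u)$ and $\mathsf{post}(u)$ be the indices of $u$ in the preorder and postorder traversals of $T$. For a nonempty subforest $G$ of $T$, let $\mathsf{LCA}(G)$ be the lowest common ancestor in $T$ of all nodes of $G$, and define the upper parts: $MU_G$ is the set of nodes on the path in $T$ from the root of $T$ to $\mathsf{LCA}(G)$, where $\mathsf{LCA}(G)$ itself is included iff $\mathsf{LCA}(G)\notin G$; $LU_G=\{u\in T\setminus MU_G:\mathsf{pre}(u)<\mathsf{pre}(v)\text{ for all }v\in G\}$; $RU_G=\{u\in T\setminus MU_G:\mathsf{post}(u)>\mathsf{post}(v)\text{ for all }v\in G\}$. -}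

module Defs where

open import Data.Nat using (ℕ; zero; suc; _<_; _≟_)
open import Data.List using (List; []; _∷_; _++_; [_]; _∷ʳ_; length)
open import Data.List.Properties using (≡-dec)
open import Data.List.Membership.Propositional using (_∈_)
open import Data.Product using (Σ; _×_)
open import Relation.Binary.PropositionalEquality using (_≡_)
open import Relation.Nullary using (¬_; yes; no)

data Tree : Set where
  node : List Tree → Tree

-- A node of T is identified by its address: the list of child indices
-- on the path from the root (root = []).
Addr : Set
Addr = List ℕ

-- Trees / forests whose nodes carry their identity (address) in T.
data LTree : Set where
  lnode : Addr → List LTree → LTree

LForest : Set
LForest = List LTree

mutual
  label : Addr → Tree → LTree
  label p (node ts) = lnode p (labelF p 0 ts)

  labelF : Addr → ℕ → List Tree → LForest
  labelF p i []       = []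
  labelF p i (t ∷ ts) = label (p ++ [ i ]) t ∷ labelF p (suc i) ts

whole : Tree → LForest
whole T = [ label [] T ]

mutual
  preT : LTree → List Addr
  preT (lnode a cs) = a ∷ preF cs

  preF : LForest → List Addr
  preF []       = []
  preF (t ∷ ts) = preT t ++ preF ts

mutual
  postT : LTree → List Addr
  postT (lnode a cs) = postF cs ++ [ a ]

  postF : LForest → List Addr
  postF []       = []
  postF (t ∷ ts) = postT t ++ postF ts

nodes : LForest → List Addr
nodes = preF

nodesT : LTree → List Addr
nodesT = preT

indexOf : List Addr → Addr → ℕ
indexOf []       u = 0
indexOf (x ∷ xs) u with ≡-dec _≟_ x u
... | yes _ = 0
... | no  _ = suc (indexOf xs u)

pre : Tree → Addr → ℕ
pre T u = indexOf (preF (whole T)) u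

post : Tree → Addr → ℕ
post T u = indexOf (postF (whole T)) u

-- Subforests: obtained from T by repeatedly removing the leftmost or
-- rightmost root (children of the removed root take its place).
data SubF (T : Tree) : LForest → Set where
  base : SubF T (whole T)
  remL : ∀ {a cs ts} → SubF T (lnode a cs ∷ ts) → SubF T (cs ++ ts)
  remR : ∀ {a cs ts} → SubF T (ts ∷ʳ lnode a cs) → SubF T (ts ++ cs)

_≼_ : Addr → Addr → Set
u ≼ w = Σ Addr (λ s → u ++ s ≡ w)

-- Longest common prefix = lowest common ancestor of two addresses.
lcp : Addr → Addr → Addr
lcp (x ∷ xs) (y ∷ ys) with x ≟ y
... | yes _ = x ∷ lcp xs ys
... | no  _ = []
lcp _ _ = []

lcaList : List Addr → Addr
lcaList []       = []
lcaList (x ∷ xs) = go x xs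
  where
  go : Addr → List Addr → Addr
  go acc []       = acc
  go acc (y ∷ ys) = go (lcp acc y) ys

LCA : LForest → Addr
LCA G = lcaList (nodes G)

MU : Tree → LForest → Addr → Set
MU T G u = u ∈ nodes (whole T) × u ≼ LCA G × (u ≡ LCA G → ¬ (LCA G ∈ nodes G))

LU : Tree → LForest → Addr → Set
LU T G u = u ∈ nodes (whole T) × ¬ MU T G u
           × (∀ v → v ∈ nodes G → pre T u < pre T v)

RU : Tree → LForest → Addr → Set
RU T G u = u ∈ nodes (whole T) × ¬ MU T G u
           × (∀ v → v ∈ nodes G → post T v < post T u)

-- Accessors for a nonempty forest  t ∷ ts.
-- L_F = t,  R'_F = ts.
lastT : LTree → LForest → LTree          -- R_F
lastT t []       = t
lastT t (u ∷ us) = lastT u us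

initT : LTree → LForest → LForest        -- L'_F = F - R_F
initT t []       = []
initT t (u ∷ us) = t ∷ initT u us

root : LTree → Addr
root (lnode a _) = a

children : LTree → LForest
children (lnode _ cs) = cs

_⊆N_ : LForest → LForest → Set
G ⊆N H = ∀ v → v ∈ nodes G → v ∈ nodes H

{-# OPTIONS --safe #-}
module Submission where

open import Defs
open import Data.Empty using (⊥; ⊥-elim)
open import Data.Nat using (suc; _<_; _≤_; _≟_; s≤s; z≤n)
open import Data.Nat.Properties using (<-irrefl; <-asym; ≤-refl; ≤-trans; n≤1+n)
open import Data.List using (List; []; _∷_; _++_; [_]; _∷ʳ_)
open import Data.List.Properties using (++-assoc; ++-identityʳ; ∷-injectiveʳ; ≡-dec)
open import Data.List.Membership.Propositional using (_∈_; _∉_)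
open import Data.List.Membership.Propositional.Properties using (∈-++⁻; ∈-++⁺ˡ; ∈-++⁺ʳ)
open import Data.List.Relation.Binary.Permutation.Propositional using (_↭_; ↭-refl; ↭-sym; ↭-trans)
open import Data.List.Relation.Binary.Permutation.Propositional.Properties
  using (∈-resp-↭; ∷↭∷ʳ)
  renaming (++⁺ to ↭-++⁺; ++⁺ʳ to ↭-++⁺ʳ)
open import Data.List.Relation.Binary.Subset.Propositional using (_⊆_)
open import Data.List.Relation.Binary.Subset.Propositional.Properties
  using (⊆-reflexive; xs⊆x∷xs; xs⊆xs++ys; ++⁺ˡ; ++⁺ʳ)
open import Data.List.Relation.Unary.Any using (here; there)
open import Data.List.Relation.Unary.All as All using (All; []; _∷_)
import Data.List.Relation.Unary.All.Properties as All
open import Data.List.Relation.Unary.AllPairs using (AllPairs; []; _∷_)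
import Data.List.Relation.Unary.AllPairs.Properties as AllPairs
open import Data.Product using (∃; ∃₂; _×_; _,_; proj₁; proj₂)
open import Data.Sum using (_⊎_; inj₁; inj₂; [_,_]′)
open import Function using (_∘_)
open import Relation.Nullary using (¬_; yes; no)
open import Relation.Binary.PropositionalEquality using (_≡_; refl; sym; cong; subst; module ≡-Reasoning)

-- Call an address u left of v (u ⊲ v) when, at the first position where they differ, u carries the
-- smaller child index. Then u precedes v in preorder and in postorder, and neither is an ancestor of
-- the other. Removing the leftmost or rightmost root keeps a subforest a sequence of subtrees of T in
-- which every node of an earlier tree lies left of every node of a later one. In each case of the
-- lemma G lies in trees of F other than the one holding u, on a fixed side, so u is left (or right)
-- of all of G. This gives the traversal inequalities, and it keeps u out of MU_G, whose nodes are
-- ancestors of LCA(G) and hence of some node of G. Finally, the root of a tree is a proper ancestor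
-- of all nodes below it, hence an ancestor of LCA(G) that does not belong to G.

AllPairs-∷ʳ⁻ : ∀ {A : Set} {R : A → A → Set} {xs x} →
               AllPairs R (xs ∷ʳ x) → AllPairs R xs × All (λ y → R y x) xs
AllPairs-∷ʳ⁻ {xs = []}    _            = [] , []
AllPairs-∷ʳ⁻ {xs = _ ∷ _} (Ryxs ∷ Rxs) =
  let Ryxs′ , Ryx = All.∷ʳ⁻ Ryxs
      Rxs′ , Rxsx = AllPairs-∷ʳ⁻ Rxs
  in Ryxs′ ∷ Rxs′ , Ryx ∷ Rxsx

≼-refl : ∀ u → u ≼ u
≼-refl u = [] , ++-identityʳ u

≼-trans : ∀ {u v w} → u ≼ v → v ≼ w → u ≼ w
≼-trans {u} (s , refl) (s′ , refl) = s ++ s′ , sym (++-assoc u s s′)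

child⋠parent : ∀ q {m} → ¬ (q ++ [ m ]) ≼ q
child⋠parent []      (_ , ())
child⋠parent (_ ∷ q) (s , eq) = child⋠parent q (s , ∷-injectiveʳ eq)

lcp-≼ˡ : ∀ a b → lcp a b ≼ a
lcp-≼ˡ []       b        = ≼-refl []
lcp-≼ˡ (x ∷ xs) []       = x ∷ xs , refl
lcp-≼ˡ (x ∷ xs) (y ∷ ys) with x ≟ y
... | yes _ = let s , eq = lcp-≼ˡ xs ys in s , cong (x ∷_) eq
... | no  _ = x ∷ xs , refl

lcp-greatest : ∀ {r a b} → r ≼ a → r ≼ b → r ≼ lcp a b
lcp-greatest {[]}    {a} {b} _ _ = lcp a b , refl
lcp-greatest {i ∷ r} (s , refl) (s′ , refl) with i ≟ i
... | yes _ = let t , eq = lcp-greatest {r} (s , refl) (s′ , refl) in t , cong (i ∷_) eq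
... | no i≢i = ⊥-elim (i≢i refl)

lcaList-≼-head : ∀ a ys → lcaList (a ∷ ys) ≼ a
lcaList-≼-head a []       = ≼-refl a
lcaList-≼-head a (y ∷ ys) = ≼-trans (lcaList-≼-head (lcp a y) ys) (lcp-≼ˡ a y)

lcaList-greatest : ∀ {r} a ys → r ≼ a → (∀ {y} → y ∈ ys → r ≼ y) → r ≼ lcaList (a ∷ ys)
lcaList-greatest a []       r≼a _    = r≼a
lcaList-greatest a (y ∷ ys) r≼a r≼ys =
  lcaList-greatest (lcp a y) ys (lcp-greatest r≼a (r≼ys (here refl))) (r≼ys ∘ there)

LCA-≼-node : ∀ {G} → ¬ G ≡ [] → ∃ λ a → a ∈ nodes G × LCA G ≼ a
LCA-≼-node {[]}              G≢[] = ⊥-elim (G≢[] refl)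
LCA-≼-node {lnode a cs ∷ Gs} _    = a , here refl , lcaList-≼-head a (preF cs ++ preF Gs)

LCA-greatest : ∀ {G r} → ¬ G ≡ [] → (∀ {v} → v ∈ nodes G → r ≼ v) → r ≼ LCA G
LCA-greatest {[]}              G≢[] _   = ⊥-elim (G≢[] refl)
LCA-greatest {lnode a cs ∷ Gs} _    r≼G = lcaList-greatest a (preF cs ++ preF Gs) (r≼G (here refl)) (r≼G ∘ there)

infix 4 _⊲_ _⊲*_ _⋖_

_⊲_ : Addr → Addr → Set
[]      ⊲ _       = ⊥
(_ ∷ _) ⊲ []      = ⊥
(i ∷ x) ⊲ (j ∷ y) = i < j ⊎ (i ≡ j × x ⊲ y)

⊲⇒⋠ : ∀ {u v} → u ⊲ v → ¬ u ≼ v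
⊲⇒⋠ {[]}    ()
⊲⇒⋠ {_ ∷ _} {[]} ()
⊲⇒⋠ {_ ∷ _} {_ ∷ _} (inj₁ i<i)         (_ , refl) = <-irrefl refl i<i
⊲⇒⋠ {_ ∷ _} {_ ∷ _} (inj₂ (refl , x⊲y)) (s , refl) = ⊲⇒⋠ x⊲y (s , refl)

⊲⇒⋡ : ∀ {u v} → u ⊲ v → ¬ v ≼ u
⊲⇒⋡ {[]}    ()
⊲⇒⋡ {_ ∷ _} {[]} ()
⊲⇒⋡ {_ ∷ _} {_ ∷ _} (inj₁ i<i)         (_ , refl) = <-irrefl refl i<i
⊲⇒⋡ {_ ∷ _} {_ ∷ _} (inj₂ (refl , x⊲y)) (s , refl) = ⊲⇒⋡ x⊲y (s , refl)

⊲-asym : ∀ {u v} → u ⊲ v → ¬ v ⊲ u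
⊲-asym {[]}    ()
⊲-asym {_ ∷ _} {[]} ()
⊲-asym {_ ∷ _} {_ ∷ _} (inj₁ i<j)          (inj₁ j<i)         = <-asym i<j j<i
⊲-asym {_ ∷ _} {_ ∷ _} (inj₁ i<i)          (inj₂ (refl , _))  = <-irrefl refl i<i
⊲-asym {_ ∷ _} {_ ∷ _} (inj₂ (refl , _))   (inj₁ i<i)         = <-irrefl refl i<i
⊲-asym {_ ∷ _} {_ ∷ _} (inj₂ (refl , x⊲y)) (inj₂ (_ , y⊲x))   = ⊲-asym x⊲y y⊲x

⊲-irrefl : ∀ {u} → ¬ u ⊲ u
⊲-irrefl u⊲u = ⊲-asym u⊲u u⊲u

siblings-⊲ : ∀ q {k m} → k < m → q ++ [ k ] ⊲ q ++ [ m ]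
siblings-⊲ []      k<m = inj₁ k<m
siblings-⊲ (_ ∷ q) k<m = inj₂ (refl , siblings-⊲ q k<m)

⊲-++ : ∀ {u v} a b → u ⊲ v → u ++ a ⊲ v ++ b
⊲-++ {[]}    _ _ ()
⊲-++ {_ ∷ _} {[]} _ _ ()
⊲-++ {_ ∷ _} {_ ∷ _} _ _ (inj₁ i<j)       = inj₁ i<j
⊲-++ {_ ∷ _} {_ ∷ _} a b (inj₂ (i≡j , x⊲y)) = inj₂ (i≡j , ⊲-++ a b x⊲y)

⊲-resp-≼ : ∀ {p q u v} → p ⊲ q → p ≼ u → q ≼ v → u ⊲ v
⊲-resp-≼ p⊲q (a , refl) (b , refl) = ⊲-++ a b p⊲q

_⊲*_ : List Addr → List Addr → Set
xs ⊲* ys = ∀ {u v} → u ∈ xs → v ∈ ys → u ⊲ v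

⊲*-disjoint : ∀ {xs ys v} → xs ⊲* ys → v ∈ ys → v ∉ xs
⊲*-disjoint xs⊲ys v∈ys v∈xs = ⊲-irrefl (xs⊲ys v∈xs v∈ys)

⊲*-monoˡ : ∀ {xs′ xs ys} → xs′ ⊆ xs → xs ⊲* ys → xs′ ⊲* ys
⊲*-monoˡ xs′⊆xs xs⊲ys u∈ v∈ = xs⊲ys (xs′⊆xs u∈) v∈

⊲*-monoʳ : ∀ {xs ys′ ys} → ys′ ⊆ ys → xs ⊲* ys → xs ⊲* ys′
⊲*-monoʳ ys′⊆ys xs⊲ys u∈ v∈ = xs⊲ys u∈ (ys′⊆ys v∈)

⊲*-++⁺ˡ : ∀ xs {ys zs} → xs ⊲* zs → ys ⊲* zs → xs ++ ys ⊲* zs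
⊲*-++⁺ˡ xs xs⊲zs ys⊲zs u∈ v∈ with ∈-++⁻ xs u∈
... | inj₁ u∈xs = xs⊲zs u∈xs v∈
... | inj₂ u∈ys = ys⊲zs u∈ys v∈

⊲*-++⁺ʳ : ∀ {xs} ys {zs} → xs ⊲* ys → xs ⊲* zs → xs ⊲* ys ++ zs
⊲*-++⁺ʳ ys xs⊲ys xs⊲zs u∈ v∈ with ∈-++⁻ ys v∈
... | inj₁ v∈ys = xs⊲ys u∈ v∈ys
... | inj₂ v∈zs = xs⊲zs u∈ v∈zs

_⋖_ : LTree → LTree → Set
A ⋖ B = preT A ⊲* preT B

Labelled : LTree → Set
Labelled A = ∃₂ λ q s → A ≡ label q s

preF-++ : ∀ F H → preF (F ++ H) ≡ preF F ++ preF H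
preF-++ []      H = refl
preF-++ (A ∷ F) H = begin
  preT A ++ preF (F ++ H)      ≡⟨ cong (preT A ++_) (preF-++ F H) ⟩
  preT A ++ (preF F ++ preF H) ≡⟨ sym (++-assoc (preT A) (preF F) (preF H)) ⟩
  (preT A ++ preF F) ++ preF H ∎
  where open ≡-Reasoning

∈-preF⁺ : ∀ {A F} → A ∈ F → preT A ⊆ preF F
∈-preF⁺ (here refl)             = ∈-++⁺ˡ
∈-preF⁺ {F = B ∷ _} (there A∈F) = ∈-++⁺ʳ (preT B) ∘ ∈-preF⁺ A∈F

children-⊆ : ∀ A → preF (children A) ⊆ preT A
children-⊆ (lnode _ _) = there

child-⊆ : ∀ {a c cs} → c ∈ cs → preT c ⊆ preT (lnode a cs)
child-⊆ c∈cs = there ∘ ∈-preF⁺ c∈cs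

root-∈ : ∀ A → root A ∈ preT A
root-∈ (lnode _ _) = here refl

mutual
  label-≼ : ∀ q s {u} → u ∈ preT (label q s) → q ≼ u
  label-≼ q (node ss) (here refl) = ≼-refl q
  label-≼ q (node ss) (there u∈)  =
    let m , _ , qm≼u = labelF-≼ q 0 ss u∈ in ≼-trans ([ m ] , refl) qm≼u

  labelF-≼ : ∀ q k ss {u} → u ∈ preF (labelF q k ss) → ∃ λ m → k ≤ m × (q ++ [ m ]) ≼ u
  labelF-≼ q k (s ∷ ss) u∈ with ∈-++⁻ (preT (label (q ++ [ k ]) s)) u∈
  ... | inj₁ u∈s  = k , ≤-refl , label-≼ (q ++ [ k ]) s u∈s
  ... | inj₂ u∈ss = let m , k<m , qm≼u = labelF-≼ q (suc k) ss u∈ss in m , ≤-trans (n≤1+n k) k<m , qm≼u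

labelF-head-⊲* : ∀ q k s ss → preT (label (q ++ [ k ]) s) ⊲* preF (labelF q (suc k) ss)
labelF-head-⊲* q k s ss u∈ v∈ =
  let m , k<m , qm≼v = labelF-≼ q (suc k) ss v∈ in
  ⊲-resp-≼ (siblings-⊲ q k<m) (label-≼ (q ++ [ k ]) s u∈) qm≼v

labelF-head-disjoint : ∀ q k s ss {v} → v ∈ preF (labelF q (suc k) ss) → v ∉ preT (label (q ++ [ k ]) s)
labelF-head-disjoint q k s ss = ⊲*-disjoint (labelF-head-⊲* q k s ss)

labelF-labelled : ∀ q k ss → All Labelled (labelF q k ss)
labelF-labelled q k []       = []
labelF-labelled q k (s ∷ ss) = (q ++ [ k ] , s , refl) ∷ labelF-labelled q (suc k) ss

labelF-sorted : ∀ q k ss → AllPairs _⋖_ (labelF q k ss)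
labelF-sorted q k []       = []
labelF-sorted q k (s ∷ ss) =
  All.tabulate (λ B∈ u∈ v∈ → labelF-head-⊲* q k s ss u∈ (∈-preF⁺ B∈ v∈)) ∷ labelF-sorted q (suc k) ss

children-labelled : ∀ {A} → Labelled A → All Labelled (children A)
children-labelled (q , node ss , refl) = labelF-labelled q 0 ss

children-sorted : ∀ {A} → Labelled A → AllPairs _⋖_ (children A)
children-sorted (q , node ss , refl) = labelF-sorted q 0 ss

⋖-children : ∀ {a cs F} → All (lnode a cs ⋖_) F → All (λ c → All (c ⋖_) F) cs
⋖-children A⋖F = All.tabulate λ c∈ → All.map (⊲*-monoˡ (child-⊆ c∈)) A⋖F

⋗-children : ∀ {a cs B} → B ⋖ lnode a cs → All (B ⋖_) cs
⋗-children B⋖A = All.tabulate λ c∈ → ⊲*-monoʳ (child-⊆ c∈) B⋖A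

All-⋖⇒⊲* : ∀ {A F} → All (A ⋖_) F → preT A ⊲* preF F
All-⋖⇒⊲* []                      _ ()
All-⋖⇒⊲* {F = B ∷ F} (A⋖B ∷ A⋖F) = ⊲*-++⁺ʳ (preT B) A⋖B (All-⋖⇒⊲* A⋖F)

head⊲*tail : ∀ {t ts} → AllPairs _⋖_ (t ∷ ts) → preT t ⊲* preF ts
head⊲*tail (t⋖ts ∷ _) = All-⋖⇒⊲* t⋖ts

All-lastT : ∀ {P : LTree → Set} t ts → All P (t ∷ ts) → P (lastT t ts)
All-lastT t []        (pt ∷ _)  = pt
All-lastT t (t′ ∷ ts) (_ ∷ pts) = All-lastT t′ ts pts

initT⊲*lastT : ∀ t ts → AllPairs _⋖_ (t ∷ ts) → preF (initT t ts) ⊲* preT (lastT t ts)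
initT⊲*lastT t []        _              ()
initT⊲*lastT t (t′ ∷ ts) (t⋖ts ∷ sorted) =
  ⊲*-++⁺ˡ (preT t) (All-lastT {t ⋖_} t′ ts t⋖ts) (initT⊲*lastT t′ ts sorted)

initT-⊆ : ∀ t ts → preF (initT t ts) ⊆ preF (t ∷ ts)
initT-⊆ t []        ()
initT-⊆ t (t′ ∷ ts) = ++⁺ʳ (preT t) (initT-⊆ t′ ts)

lastT-⊆ : ∀ t ts → preT (lastT t ts) ⊆ preF (t ∷ ts)
lastT-⊆ t []        = ∈-++⁺ˡ
lastT-⊆ t (t′ ∷ ts) = ∈-++⁺ʳ (preT t) ∘ lastT-⊆ t′ ts

subforest-⊆ : ∀ {T F} → SubF T F → nodes F ⊆ nodes (whole T)
subforest-⊆ base = λ u∈ → u∈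
subforest-⊆ (remL {a} {cs} {ts} F) =
  subforest-⊆ F ∘ ++⁺ˡ (preF ts) (xs⊆x∷xs (preF cs) a) ∘ ⊆-reflexive (preF-++ cs ts)
subforest-⊆ (remR {a} {cs} {ts} F) =
  subforest-⊆ F ∘ ⊆-reflexive (sym (preF-++ ts [ lnode a cs ]))
                ∘ ++⁺ʳ (preF ts) (there ∘ xs⊆xs++ys (preF cs) [])
                ∘ ⊆-reflexive (preF-++ ts cs)

subforest-labelled : ∀ {T F} → SubF T F → All Labelled F
subforest-labelled base = ([] , _ , refl) ∷ []
subforest-labelled (remL F) with subforest-labelled F
... | A-lab ∷ labs = All.++⁺ (children-labelled A-lab) labs
subforest-labelled (remR F) with All.∷ʳ⁻ (subforest-labelled F)
... | labs , A-lab = All.++⁺ labs (children-labelled A-lab)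

subforest-sorted : ∀ {T F} → SubF T F → AllPairs _⋖_ F
subforest-sorted base = [] ∷ []
subforest-sorted (remL F) with subforest-labelled F | subforest-sorted F
... | A-lab ∷ _ | A⋖ts ∷ sorted =
  AllPairs.++⁺ (children-sorted A-lab) sorted (⋖-children A⋖ts)
subforest-sorted (remR F) with All.∷ʳ⁻ (subforest-labelled F) | AllPairs-∷ʳ⁻ (subforest-sorted F)
... | _ , A-lab | sorted , ts⋖A =
  AllPairs.++⁺ sorted (children-sorted A-lab) (All.map ⋗-children ts⋖A)

mutual
  preT↭postT : ∀ A → preT A ↭ postT A
  preT↭postT (lnode a cs) = ↭-trans (∷↭∷ʳ a (preF cs)) (↭-++⁺ʳ [ a ] (preF↭postF cs))

  preF↭postF : ∀ F → preF F ↭ postF F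
  preF↭postF []      = ↭-refl
  preF↭postF (A ∷ F) = ↭-++⁺ (preT↭postT A) (preF↭postF F)

∈-preT⇒∈-postT : ∀ A {u} → u ∈ preT A → u ∈ postT A
∈-preT⇒∈-postT A = ∈-resp-↭ (preT↭postT A)

∈-postT⇒∈-preT : ∀ A {u} → u ∈ postT A → u ∈ preT A
∈-postT⇒∈-preT A = ∈-resp-↭ (↭-sym (preT↭postT A))

data Precedes : List Addr → Addr → Addr → Set where
  split : ∀ {u v} xs ys → u ∈ xs → v ∉ xs → Precedes (xs ++ ys) u v

precedes-∷ : ∀ {L u v} x → ¬ v ≡ x → Precedes L u v → Precedes (x ∷ L) u v
precedes-∷ x v≢x (split xs ys u∈ v∉) =
  split (x ∷ xs) ys (there u∈) λ { (here v≡x) → v≢x v≡x ; (there v∈) → v∉ v∈ }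

precedes-++ˡ : ∀ {L u v} zs → v ∉ zs → Precedes L u v → Precedes (zs ++ L) u v
precedes-++ˡ {u = u} {v} zs v∉zs (split xs ys u∈ v∉) =
  subst (λ L → Precedes L u v) (++-assoc zs xs ys)
    (split (zs ++ xs) ys (∈-++⁺ʳ zs u∈) λ v∈ → [ v∉zs , v∉ ]′ (∈-++⁻ zs v∈))

precedes-++ʳ : ∀ {L u v} zs → Precedes L u v → Precedes (L ++ zs) u v
precedes-++ʳ {u = u} {v} zs (split xs ys u∈ v∉) =
  subst (λ L → Precedes L u v) (sym (++-assoc xs ys zs)) (split xs (ys ++ zs) u∈ v∉)

indexOf-++-< : ∀ xs ys {u v} → u ∈ xs → v ∉ xs → indexOf (xs ++ ys) u < indexOf (xs ++ ys) v
indexOf-++-< (x ∷ xs) ys {u} {v} u∈ v∉ with ≡-dec _≟_ x u | ≡-dec _≟_ x v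
... | _       | yes x≡v = ⊥-elim (v∉ (here (sym x≡v)))
... | yes _   | no _    = s≤s z≤n
... | no x≢u  | no _    with u∈
...   | here u≡x  = ⊥-elim (x≢u (sym u≡x))
...   | there u∈xs = s≤s (indexOf-++-< xs ys u∈xs (v∉ ∘ there))

precedes⇒indexOf< : ∀ {L u v} → Precedes L u v → indexOf L u < indexOf L v
precedes⇒indexOf< (split xs ys u∈ v∉) = indexOf-++-< xs ys u∈ v∉

mutual
  label-precedes : ∀ q s {u v} → u ∈ preT (label q s) → v ∈ preT (label q s) → u ⊲ v →
                   Precedes (preT (label q s)) u v × Precedes (postT (label q s)) u v
  label-precedes q s@(node ss) (here refl) v∈ u⊲v = ⊥-elim (⊲⇒⋠ u⊲v (label-≼ q s v∈))
  label-precedes q s@(node ss) (there u∈)  v∈ u⊲v with q≼u ← label-≼ q s (there u∈) | v∈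
  ... | here refl = ⊥-elim (⊲⇒⋡ u⊲v q≼u)
  ... | there v∈′ =
    let onPre , onPost = labelF-precedes q 0 ss u∈ v∈′ u⊲v in
    precedes-∷ q (λ { refl → ⊲⇒⋡ u⊲v q≼u }) onPre , precedes-++ʳ [ q ] onPost

  labelF-precedes : ∀ q k ss {u v} → u ∈ preF (labelF q k ss) → v ∈ preF (labelF q k ss) → u ⊲ v →
                    Precedes (preF (labelF q k ss)) u v × Precedes (postF (labelF q k ss)) u v
  labelF-precedes q k (s ∷ ss) u∈ v∈ u⊲v
    with ∈-++⁻ (preT (label (q ++ [ k ]) s)) u∈ | ∈-++⁻ (preT (label (q ++ [ k ]) s)) v∈
  ... | inj₁ u∈s  | inj₁ v∈s  =
    let onPre , onPost = label-precedes (q ++ [ k ]) s u∈s v∈s u⊲v in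
    precedes-++ʳ _ onPre , precedes-++ʳ _ onPost
  ... | inj₁ u∈s  | inj₂ v∈ss =
    let v∉s = labelF-head-disjoint q k s ss v∈ss in
    split _ _ u∈s v∉s , split _ _ (∈-preT⇒∈-postT _ u∈s) (v∉s ∘ ∈-postT⇒∈-preT _)
  ... | inj₂ u∈ss | inj₁ v∈s  = ⊥-elim (⊲-asym u⊲v (labelF-head-⊲* q k s ss v∈s u∈ss))
  ... | inj₂ u∈ss | inj₂ v∈ss =
    let onPre , onPost = labelF-precedes q (suc k) ss u∈ss v∈ss u⊲v
        v∉s = labelF-head-disjoint q k s ss v∈ss
    in precedes-++ˡ _ v∉s onPre , precedes-++ˡ _ (v∉s ∘ ∈-postT⇒∈-preT _) onPost

⊲⇒pre<×post< : ∀ T {u v} → u ∈ nodes (whole T) → v ∈ nodes (whole T) → u ⊲ v →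
               pre T u < pre T v × post T u < post T v
⊲⇒pre<×post< T u∈ v∈ u⊲v =
  let onPre , onPost = label-precedes [] T (inRoot u∈) (inRoot v∈) u⊲v in
  precedes⇒indexOf< (precedes-++ʳ [] onPre) , precedes⇒indexOf< (precedes-++ʳ [] onPost)
  where
  inRoot : ∀ {u} → u ∈ nodes (whole T) → u ∈ preT (label [] T)
  inRoot u∈ = ⊆-reflexive (++-identityʳ _) u∈

⊲-all⇒¬MU : ∀ T {G u} → ¬ G ≡ [] → (∀ {v} → v ∈ nodes G → u ⊲ v) → ¬ MU T G u
⊲-all⇒¬MU T G≢[] u⊲G (_ , u≼lca , _) =
  let a , a∈G , lca≼a = LCA-≼-node G≢[] in ⊲⇒⋠ (u⊲G a∈G) (≼-trans u≼lca lca≼a)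

⊳-all⇒¬MU : ∀ T {G u} → ¬ G ≡ [] → (∀ {v} → v ∈ nodes G → v ⊲ u) → ¬ MU T G u
⊳-all⇒¬MU T G≢[] G⊲u (_ , u≼lca , _) =
  let a , a∈G , lca≼a = LCA-≼-node G≢[] in ⊲⇒⋡ (G⊲u a∈G) (≼-trans u≼lca lca≼a)

⊲-all⇒LU : ∀ T {G u} → ¬ G ≡ [] → nodes G ⊆ nodes (whole T) → u ∈ nodes (whole T) →
           (∀ {v} → v ∈ nodes G → u ⊲ v) → LU T G u
⊲-all⇒LU T G≢[] G⊆T u∈T u⊲G =
  u∈T , ⊲-all⇒¬MU T G≢[] u⊲G , λ _ v∈G → proj₁ (⊲⇒pre<×post< T u∈T (G⊆T v∈G) (u⊲G v∈G))

⊳-all⇒RU : ∀ T {G u} → ¬ G ≡ [] → nodes G ⊆ nodes (whole T) → u ∈ nodes (whole T) →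
           (∀ {v} → v ∈ nodes G → v ⊲ u) → RU T G u
⊳-all⇒RU T G≢[] G⊆T u∈T G⊲u =
  u∈T , ⊳-all⇒¬MU T G≢[] G⊲u , λ _ v∈G → proj₂ (⊲⇒pre<×post< T (G⊆T v∈G) u∈T (G⊲u v∈G))

below-root⇒MU : ∀ T {G A} → Labelled A → root A ∈ nodes (whole T) → ¬ G ≡ [] →
                nodes G ⊆ nodes (children A) → MU T G (root A)
below-root⇒MU T {G} (q , node ss , refl) q∈T G≢[] G⊆ =
  q∈T , LCA-greatest G≢[] (proj₁ ∘ strictly-below ∘ G⊆) ,
  λ q≡lca lca∈G → proj₂ (strictly-below (G⊆ (subst (_∈ nodes G) (sym q≡lca) lca∈G))) refl
  where
  strictly-below : ∀ {v} → v ∈ preF (labelF q 0 ss) → q ≼ v × ¬ v ≡ q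
  strictly-below v∈ =
    let m , _ , qm≼v = labelF-≼ q 0 ss v∈ in
    ≼-trans ([ m ] , refl) qm≼v , λ { refl → child⋠parent q qm≼v }

lemma11 : (T : Tree) (t : LTree) (ts : LForest) → SubF T (t ∷ ts) →
  -- (1a) G ⊆ L'_F  ⇒  R_F ⊆ RU_G
  ((G : LForest) → SubF T G → ¬ G ≡ [] → G ⊆N initT t ts →
    ∀ u → u ∈ nodesT (lastT t ts) → RU T G u)
  × -- (1b) G ⊆ R'_F  ⇒  L_F ⊆ LU_G
  ((G : LForest) → SubF T G → ¬ G ≡ [] → G ⊆N ts →
    ∀ u → u ∈ nodesT t → LU T G u)
  × -- (2a) G ⊆ R°_F  ⇒  L'_F ⊆ LU_G  and  r_F ∈ MU_G
  ((G : LForest) → SubF T G → ¬ G ≡ [] → G ⊆N children (lastT t ts) →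
    (∀ u → u ∈ nodes (initT t ts) → LU T G u) × MU T G (root (lastT t ts)))
  × -- (2b) G ⊆ L°_F  ⇒  R'_F ⊆ RU_G  and  ℓ_F ∈ MU_G
  ((G : LForest) → SubF T G → ¬ G ≡ [] → G ⊆N children t →
    (∀ u → u ∈ nodes ts → RU T G u) × MU T G (root t))
lemma11 T t ts F =
  (λ G _ G≢[] G⊆ _ u∈ →
    ⊳-all⇒RU T G≢[] (inT ∘ initT-⊆ t ts ∘ G⊆ _) (inT (lastT-⊆ t ts u∈))
      λ v∈ → init⊲last (G⊆ _ v∈) u∈) ,
  (λ G _ G≢[] G⊆ _ u∈ →
    ⊲-all⇒LU T G≢[] (inT ∘ ∈-++⁺ʳ (preT t) ∘ G⊆ _) (inT (∈-++⁺ˡ u∈))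
      λ v∈ → head⊲tail u∈ (G⊆ _ v∈)) ,
  (λ G _ G≢[] G⊆ →
    (λ _ u∈ → ⊲-all⇒LU T G≢[] (inT ∘ lastT-⊆ t ts ∘ children-⊆ last ∘ G⊆ _) (inT (initT-⊆ t ts u∈))
      λ v∈ → init⊲last u∈ (children-⊆ last (G⊆ _ v∈))) ,
    below-root⇒MU T (All-lastT t ts labelled) (inT (lastT-⊆ t ts (root-∈ last))) G≢[] (G⊆ _)) ,
  (λ G _ G≢[] G⊆ →
    (λ _ u∈ → ⊳-all⇒RU T G≢[] (inT ∘ ∈-++⁺ˡ ∘ children-⊆ t ∘ G⊆ _) (inT (∈-++⁺ʳ (preT t) u∈))
      λ v∈ → head⊲tail (children-⊆ t (G⊆ _ v∈)) u∈) ,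
    below-root⇒MU T (All.head labelled) (inT (∈-++⁺ˡ (root-∈ t))) G≢[] (G⊆ _))
  where
  inT : nodes (t ∷ ts) ⊆ nodes (whole T)
  inT = subforest-⊆ F
  labelled : All Labelled (t ∷ ts)
  labelled = subforest-labelled F
  last : LTree
  last = lastT t ts
  init⊲last : preF (initT t ts) ⊲* preT last
  init⊲last = initT⊲*lastT t ts (subforest-sorted F)
  head⊲tail : preT t ⊲* preF ts
  head⊲tail = head⊲*tail (subforest-sorted F)
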